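{- Consider a flight $(i,j,k)$ and two speeds $v,s\in V$ with $s>v$. Suppose that (1) there is no customer $l\in C$, $l\neq j$ (and $l\notin\{i,k\}$), with $e^v_{ijk} + \max\left( \tau^{\text{T}}_{il} + \tau_l^{\text{S,T}} + \tau^{\text{T}}_{lk} - \tau^v_{ijk}, 0\right) P^{\text{H}}(0) \leq \epsilon E$; (2) there is no customer $l\in C$, $l\neq j$ (and $l\notin\{i,k\}$), with $e^s_{ijk} + \max\left( \tau^{\text{T}}_{il} + \tau_l^{\text{S,T}} + \tau^{\text{T}}_{lk} - \tau^s_{ijk}, 0\right) P^{\text{H}}(0) \leq \epsilon E$; (3) $\tau^v_{ijk} > \tau^{\text{T}}_{ik}$ and $e^{s}_{ijk} + \max\left( \tau^{\text{T}}_{ik} - \tau^s_{ijk}, 0 \right) P^{\text{H}}(0) \leq e^v_{ijk}$. Then the operation $(i,j,k)^v$ is dominated by the operation $(i,j,k)^s$.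
   Context: Setting (vehicle routing problem with drones and drone speed selection). The nodes are a start depot $0$, customers $C=\{1,\dots,c\}$, and an end depot $c+1$ (same physical location as $0$); $\bar C\subseteq C$ is the set of customers that may be served by a drone. For nodes $a,b$, $\tau^{\text{T}}_{ab}\ge 0$ is the truck travel time from $a$ to $b$, and $\tau^{\text{S,T}}_l\ge 0$ is the truck service time at customer $l$. The drone distance between $a$ and $b$ is $\delta^{\text{D}}_{ab}\ge0$, the drone service time at customer $j$ is $\tau^{\text{S,D}}_j\ge 0$, and a drone can fly at any speed from a finite set $V\subset(0,\infty)$. A flight is a triple $(i,j,k)$ of pairwise distinct nodes (launch node $i\neq c+1$, customer $j\in\bar C$, retrieval node $k\neq 0$). An operation $(i,j,k)^v$ is the execution of the flight at constant speed $v\in V$; its duration is $\tau^v_{ijk}=\delta^{\text{D}}_{ij}/v+\tau^{\text{S,D}}_j+\delta^{\text{D}}_{jk}/v$, and its flight energy consumption is a given number $e^v_{ijk}\ge 0$. $P^{\text{H}}(0)>0$ denotes the power consumed by the drone when hovering without a package, and $\epsilon E>0$ is the maximum usable battery energy. Scenario semantics: measure time from the launch at $i$, at which moment the truck also leaves $i$. Let $T$ be the time at which the truck arrives at $k$. The drone reaches $k$ at time $\tau^v_{ijk}$ and hovers until the truck arrives, so the reunion occurs at time $\max(\tau^v_{ijk},T)$ and the energy consumed until reunion is $e^v_{ijk}+\max(T-\tau^v_{ijk},0)\,P^{\text{H}}(0)$. The operation is feasible in the scenario iff this energy is at most $\epsilon E$. Admissible scenarios: always $T\ge\tau^{\text{T}}_{ik}$;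 if the truck travels directly from $i$ to $k$ then $T=\tau^{\text{T}}_{ik}$; if the truck visits some customer $l\notin\{i,j,k\}$ between $i$ and $k$, then $T\ge \tau^{\text{T}}_{il}+\tau^{\text{S,T}}_l+\tau^{\text{T}}_{lk}$. Dominance: an operation $A$ of flight $(i,j,k)$ is dominated by an operation $B$ of the same flight if, in every admissible scenario in which $A$ is feasible, $B$ is also feasible, the reunion time with $B$ is no later than with $A$, and the energy consumed until reunion with $B$ is no larger than with $A$.
   Formalization: The truck and drone times, drone distances, flight energies $e^v_{ijk}$, speeds in $V$, $P^{\text{H}}(0)$, $\epsilon E$ and the truck arrival time $T$ are all rational. -}

module Defs where

open import Data.Nat using (ℕ; suc)
open import Data.Fin using (Fin; zero; fromℕ)
open import Data.Rational using (ℚ; 0ℚ; _+_; _-_; _*_; _÷_; _⊔_; _≤_; _<_; Positive; NonNegative)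
open import Data.Rational.Properties using (pos⇒nonZero)
open import Data.List using (List)
open import Data.List.Membership.Propositional using (_∈_)
open import Data.Product using (_×_; Σ)
open import Data.Sum using (_⊎_)
open import Relation.Binary.PropositionalEquality using (_≡_; _≢_)
open import Relation.Nullary using (¬_)

-- Nodes of an instance with c customers: 0 = start depot,
-- 1..c = customers, c+1 = end depot.
Node : ℕ → Set
Node c = Fin (suc (suc c))

start : ∀ {c} → Node c
start = zero

end : ∀ {c} → Node c
end {c} = fromℕ (suc c)

IsCustomer : ∀ {c} → Node c → Set
IsCustomer l = (l ≢ start) × (l ≢ end)

record Speed : Set where
  constructor speed
  field
    val : ℚ
    pos : Positive val
open Speed public

record Instance (c : ℕ) : Set₁ where
  field
    τT   : Node c → Node c → ℚ          -- truck travel time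
    τST  : Node c → ℚ                   -- truck service time
    δD   : Node c → Node c → ℚ          -- drone distance
    τSD  : Node c → ℚ                   -- drone service time
    Cbar : Node c → Set                 -- customers drone-eligible
    V    : List Speed
    e    : Node c → Node c → Node c → Speed → ℚ
    PH0  : ℚ                            -- hovering power without package
    εE   : ℚ                            -- usable battery energy
    τT-nonneg  : ∀ a b → NonNegative (τT a b)
    τST-nonneg : ∀ l → NonNegative (τST l)
    δD-nonneg  : ∀ a b → NonNegative (δD a b)
    τSD-nonneg : ∀ j → NonNegative (τSD j)
    e-nonneg   : ∀ i j k v → NonNegative (e i j k v)
    Cbar-cust  : ∀ j → Cbar j → IsCustomer j
    PH0-pos    : Positive PH0
    εE-pos     : Positive εE

module _ {c : ℕ} (I : Instance c) where
  open Instance I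

  IsFlight : Node c → Node c → Node c → Set
  IsFlight i j k =
    (i ≢ end) × Cbar j × (k ≢ start) × (i ≢ j) × (j ≢ k) × (i ≢ k)

  dur : Node c → Node c → Node c → Speed → ℚ
  dur i j k (speed v p) =
    ((δD i j ÷ v) {{pos⇒nonZero v {{p}}}}) + τSD j + ((δD j k ÷ v) {{pos⇒nonZero v {{p}}}})

  -- reunion time when the truck arrives at k at time T
  reunion : Node c → Node c → Node c → Speed → ℚ → ℚ
  reunion i j k v T = dur i j k v ⊔ T

  energy : Node c → Node c → Node c → Speed → ℚ → ℚ
  energy i j k v T = e i j k v + ((T - dur i j k v) ⊔ 0ℚ) * PH0

  Feasible : Node c → Node c → Node c → Speed → ℚ → Set
  Feasible i j k v T = energy i j k v T ≤ εE

  detour : Node c → Node c → Node c → ℚ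
  detour i l k = τT i l + τST l + τT l k

  -- admissible scenarios (truck arrival times T at k) for flight (i,j,k)
  Admissible : Node c → Node c → Node c → ℚ → Set
  Admissible i j k T =
    (τT i k ≤ T) ×
    ((T ≡ τT i k) ⊎
     Σ (Node c) (λ l → IsCustomer l × (l ≢ i) × (l ≢ j) × (l ≢ k) × (detour i l k ≤ T)))

  Dominated : Node c → Node c → Node c → Speed → Speed → Set
  Dominated i j k v s =
    ∀ T → Admissible i j k T → Feasible i j k v T →
      Feasible i j k s T × (reunion i j k s T ≤ reunion i j k v T)
                         × (energy i j k s T ≤ energy i j k v T)

  NoFeasibleDetour : Node c → Node c → Node c → Speed → Set
  NoFeasibleDetour i j k v =
    ∀ l → IsCustomer l → l ≢ i → l ≢ j → l ≢ k →
      ¬ (e i j k v + ((detour i l k - dur i j k v) ⊔ 0ℚ) * PH0 ≤ εE)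

{-# OPTIONS --safe #-}
module Submission where

open import Defs
open import Data.Nat using (ℕ)
open import Data.Rational using (ℚ; 0ℚ; 1ℚ; _+_; _-_; _*_; _⊔_; _≤_; _<_; 1/_; -_; Positive)
open import Data.Rational.Properties
open import Data.List.Membership.Propositional using (_∈_)
open import Data.Product using (_×_; _,_)
open import Data.Sum using (inj₁; inj₂)
open import Relation.Binary.PropositionalEquality using (_≡_; _≢_; refl; sym; cong; subst; module ≡-Reasoning)
open import Relation.Nullary using (¬_; contradiction)

-- The energy until reunion is nondecreasing in the truck's arrival time T.
-- Hence, when the truck first serves a customer l, the energy at speed v is at
-- least the value excluded by (1), so the slower operation is infeasible and
-- only the direct scenario T = τT i k remains.  There τT i k < τ^v, so the slower
-- drone never hovers and spends exactly e^v, which bounds the energy at speed s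
-- by (3); and the faster flight is shorter, so it reunites no later.

1/-antimono-≤-pos : ∀ {p q} .{{_ : Positive p}} .{{_ : Positive q}} →
                    p ≤ q → (1/ q) {{pos⇒nonZero q}} ≤ (1/ p) {{pos⇒nonZero p}}
1/-antimono-≤-pos {p} {q} p≤q = begin
  1/ q                 ≡⟨ *-identityˡ (1/ q) ⟨
  1ℚ * 1/ q            ≡⟨ cong (_* 1/ q) (*-inverseˡ p) ⟨
  (1/ p * p) * 1/ q    ≤⟨ *-monoʳ-≤-nonNeg (1/ q) {{pos⇒nonNeg (1/ q) {{1/pos⇒pos q}}}}
                            (*-monoˡ-≤-nonNeg (1/ p) {{pos⇒nonNeg (1/ p) {{1/pos⇒pos p}}}} p≤q) ⟩
  (1/ p * q) * 1/ q    ≡⟨ *-assoc (1/ p) q (1/ q) ⟩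
  1/ p * (q * 1/ q)    ≡⟨ cong (1/ p *_) (*-inverseʳ q) ⟩
  1/ p * 1ℚ            ≡⟨ *-identityʳ (1/ p) ⟩
  1/ p                 ∎
  where
  open ≤-Reasoning
  instance
    _ = pos⇒nonZero p
    _ = pos⇒nonZero q

p≤q⇒p-q≤0 : ∀ {p q} → p ≤ q → p - q ≤ 0ℚ
p≤q⇒p-q≤0 {p} {q} p≤q = subst (p - q ≤_) (+-inverseʳ q) (+-monoˡ-≤ (- q) p≤q)

module _ {c : ℕ} (I : Instance c) where
  open Instance I

  dur-antimono : ∀ {i j k} (v s : Speed) → val v ≤ val s → dur I i j k s ≤ dur I i j k v
  dur-antimono {i} {j} {k} (speed v pv) (speed s ps) v≤s =
    +-mono-≤ (+-monoˡ-≤ (τSD j) (slower i j)) (slower j k)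
    where
    instance
      _ = pv
      _ = ps
      _ = pos⇒nonZero v
      _ = pos⇒nonZero s
    slower : ∀ a b → δD a b * 1/ s ≤ δD a b * 1/ v
    slower a b = *-monoˡ-≤-nonNeg (δD a b) {{δD-nonneg a b}} (1/-antimono-≤-pos v≤s)

  energy-mono : ∀ {i j k} v {T T′} → T ≤ T′ → energy I i j k v T ≤ energy I i j k v T′
  energy-mono {i} {j} {k} v T≤T′ =
    +-monoʳ-≤ (e i j k v)
      (*-monoʳ-≤-nonNeg PH0 {{pos⇒nonNeg PH0 {{PH0-pos}}}}
        (⊔-monoˡ-≤ 0ℚ (+-monoˡ-≤ (- dur I i j k v) T≤T′)))

  energy-early : ∀ {i j k} v {T} → T ≤ dur I i j k v → energy I i j k v T ≡ e i j k v
  energy-early {i} {j} {k} v {T} T≤dur = begin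
    e i j k v + ((T - dur I i j k v) ⊔ 0ℚ) * PH0  ≡⟨ cong (λ h → e i j k v + h * PH0)
                                                        (p≤q⇒p⊔q≡q (p≤q⇒p-q≤0 T≤dur)) ⟩
    e i j k v + 0ℚ * PH0                          ≡⟨ cong (e i j k v +_) (*-zeroˡ PH0) ⟩
    e i j k v + 0ℚ                                ≡⟨ +-identityʳ (e i j k v) ⟩
    e i j k v                                     ∎
    where open ≡-Reasoning

  detour-infeasible : ∀ {i j k l} v {T} → NoFeasibleDetour I i j k v →
                      IsCustomer l → l ≢ i → l ≢ j → l ≢ k → detour I i l k ≤ T →
                      ¬ Feasible I i j k v T
  detour-infeasible v noDetour cust l≢i l≢j l≢k detour≤T feasible =
    noDetour _ cust l≢i l≢j l≢k (≤-trans (energy-mono v detour≤T) feasible)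

proposition3 : ∀ {c : ℕ} (I : Instance c) (i j k : Node c) (v s : Speed) →
    IsFlight I i j k → v ∈ Instance.V I → s ∈ Instance.V I → val v < val s →
    NoFeasibleDetour I i j k v →
    NoFeasibleDetour I i j k s →
    Instance.τT I i k < dur I i j k v →
    Instance.e I i j k s + ((Instance.τT I i k - dur I i j k s) ⊔ 0ℚ) * Instance.PH0 I ≤ Instance.e I i j k v →
    Dominated I i j k v s
proposition3 I i j k v s _ _ _ _ noDetourᵥ _ _ _ T (_ , inj₂ (l , cust , l≢i , l≢j , l≢k , detour≤T)) feasibleᵥ =
  contradiction feasibleᵥ (detour-infeasible I v noDetourᵥ cust l≢i l≢j l≢k detour≤T)
proposition3 I i j k v s _ _ _ v<s _ _ direct<durᵥ energyₛ≤eᵥ T (_ , inj₁ refl) feasibleᵥ =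
  ≤-trans energyₛ≤energyᵥ feasibleᵥ ,
  ⊔-monoˡ-≤ (Instance.τT I i k) (dur-antimono I v s (<⇒≤ v<s)) ,
  energyₛ≤energyᵥ
  where
  energyₛ≤energyᵥ : energy I i j k s (Instance.τT I i k) ≤ energy I i j k v (Instance.τT I i k)
  energyₛ≤energyᵥ = subst (energy I i j k s (Instance.τT I i k) ≤_)
                          (sym (energy-early I v (<⇒≤ direct<durᵥ))) energyₛ≤eᵥ
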